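{- For every $d \ge 1$ there is a non-evasive simplicial $d$-complex $E_d$ with exactly two free faces, and these two free faces share a common codimension-one face.
   Context: A face $\sigma$ of a simplicial complex $C$ is free if it is properly contained in exactly one other face of $C$. Non-evasiveness is defined recursively: a single vertex is non-evasive, and a simplicial complex $C$ with more than one vertex is non-evasive if there is a vertex $v$ of $C$ such that both the link $\mathrm{lk}_C(v)$ and the deletion $C - v$ (the subcomplex of faces not containing $v$) are non-evasive. -}

module Defs where

open import Data.Nat using (ℕ; suc; _≤_)
open import Data.Bool using (Bool; true; false; not; _∧_)
open import Data.Fin using (Fin)
open import Data.Fin.Subset using (Subset; ⁅_⁆; _⊆_; _⊂_; _∪_; ∣_∣)
open import Data.Vec using (lookup)
open import Data.Product using (Σ; ∃; ∃-syntax; _×_)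
open import Data.Sum using (_⊎_)
open import Relation.Binary.PropositionalEquality using (_≡_)
open import Relation.Nullary using (¬_)

Faces : ℕ → Set
Faces n = Subset n → Bool

record SimplicialComplex (n : ℕ) : Set where
  field
    face     : Faces n
    nonempty : ∃[ σ ] face σ ≡ true
    closed   : ∀ σ τ → τ ⊆ σ → face σ ≡ true → face τ ≡ true
open SimplicialComplex public

IsFace : ∀ {n} → Faces n → Subset n → Set
IsFace C σ = C σ ≡ true

IsVertex : ∀ {n} → Faces n → Fin n → Set
IsVertex C v = IsFace C ⁅ v ⁆

link : ∀ {n} → Faces n → Fin n → Faces n
link C v σ = not (lookup σ v) ∧ C (σ ∪ ⁅ v ⁆)

deletion : ∀ {n} → Faces n → Fin n → Faces n
deletion C v σ = not (lookup σ v) ∧ C σ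

SingleVertex : ∀ {n} → Faces n → Set
SingleVertex C = ∃[ v ] (IsVertex C v × (∀ w → IsVertex C w → w ≡ v))

MoreThanOneVertex : ∀ {n} → Faces n → Set
MoreThanOneVertex C = ∃[ v ] ∃[ w ] (IsVertex C v × IsVertex C w × ¬ v ≡ w)

data NonEvasive {n : ℕ} (C : Faces n) : Set where
  single : SingleVertex C → NonEvasive C
  step   : MoreThanOneVertex C → (v : Fin n) → IsVertex C v →
           NonEvasive (link C v) → NonEvasive (deletion C v) → NonEvasive C

HasDimension : ∀ {n} → Faces n → ℕ → Set
HasDimension C d = (∃[ σ ] (IsFace C σ × ∣ σ ∣ ≡ suc d))
                 × (∀ σ → IsFace C σ → ∣ σ ∣ ≤ suc d)

IsFree : ∀ {n} → Faces n → Subset n → Set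
IsFree C σ = IsFace C σ ×
  (∃[ τ ] (IsFace C τ × σ ⊂ τ × (∀ τ' → IsFace C τ' → σ ⊂ τ' → τ' ≡ τ)))

ExactlyTwoFree : ∀ {n} → Faces n → Subset n → Subset n → Set
ExactlyTwoFree C σ₁ σ₂ = ¬ σ₁ ≡ σ₂ × IsFree C σ₁ × IsFree C σ₂ ×
  (∀ σ → IsFree C σ → σ ≡ σ₁ ⊎ σ ≡ σ₂)

CodimOneFace : ∀ {n} → Faces n → Subset n → Subset n → Set
CodimOneFace C ρ σ = IsFace C ρ × ρ ⊆ σ × suc ∣ ρ ∣ ≡ ∣ σ ∣

-- E₁ is the path A = 0–1–2–3, whose free faces are its end vertices, meeting in
-- the empty face. Then E_{d+1} = B_d ∪ (apex ∗ E_d), where B₁ is a non-evasive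
-- 2-complex containing A whose free faces are exactly the edges of A, and
-- B_{d+1} is the cone over B_d. Coning preserves non-evasiveness, because the
-- link and the deletion of the apex are E_d and B_d. Every face of E_d lies in a
-- larger face of B_d and every free face of B_d lies in E_d; so a face of B_d is
-- never free in E_{d+1}, and the free faces of E_{d+1} are exactly the cones over
-- those of E_d. Both invariants pass from (E_d, B_d) to (E_{d+1}, B_{d+1}).
module Submission where

open import Defs
open import Data.Nat using (ℕ; zero; suc; _+_; _≥_; _≤_; _≤?_; s≤s)
open import Data.Nat.Properties using (m≤n⇒m≤1+n; +-comm)
open import Data.Bool using (true; not; _∧_)
open import Data.Bool.ListAction using (any)
import Data.Bool.Properties as Bool
open import Data.Fin using (Fin; zero; suc; #_)
import Data.Fin.Properties as Fin
open import Data.Fin.Subset using (Subset; inside; outside; _⊆_; _⊂_; ⁅_⁆; ∣_∣; ⊥)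
open import Data.Fin.Subset.Properties
  using (anySubset?; _⊆?_; _⊂?_; ⊥⊆; ⊆-refl; s⊆s; drop-∷-⊆; drop-∷-⊂; in⊂in; out⊂; out⊂in; ∪-identityʳ)
open import Data.List using (List; []; _∷_)
open import Data.Maybe using (Maybe; just; nothing; from-just; _>>=_)
open import Data.Vec using ([]; _∷_; here; tail)
import Data.Vec.Properties as Vec
open import Data.Product using (∃-syntax; _×_; _,_; proj₁)
open import Data.Empty using (⊥-elim)
open import Data.Sum using (_⊎_)
import Data.Sum as Sum
open import Function using (_∘_)
open import Relation.Binary.Definitions using (DecidableEquality)
open import Relation.Binary.PropositionalEquality
  using (_≡_; refl; sym; trans; cong; subst; _≗_)
open import Relation.Nullary using (¬_; Dec; yes; no; ¬?; _×-dec_; _⊎-dec_; _→-dec_; does; contradiction)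
open import Relation.Nullary.Decidable using (map′; decidable-stable; from-yes; dec⇒maybe)
open import Relation.Unary using (Pred; Decidable)

private
  variable
    n : ℕ
    C D X Y : Faces n

DownClosed : Faces n → Set
DownClosed C = ∀ σ τ → τ ⊆ σ → IsFace C σ → IsFace C τ


allSubset? : ∀ {ℓ} {P : Pred (Subset n) ℓ} → Decidable P → Dec (∀ σ → P σ)
allSubset? P? = map′
  (λ ∄¬P σ → decidable-stable (P? σ) (λ ¬Pσ → ∄¬P (σ , ¬Pσ)))
  (λ ∀P (σ , ¬Pσ) → ¬Pσ (∀P σ))
  (¬? (anySubset? (¬? ∘ P?)))

_≟ˢ_ : DecidableEquality (Subset n)
_≟ˢ_ = Vec.≡-dec Bool._≟_

IsFace? : (C : Faces n) → Decidable (IsFace C)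
IsFace? C σ = C σ Bool.≟ true

IsFree? : (C : Faces n) → Decidable (IsFree C)
IsFree? C σ = IsFace? C σ ×-dec anySubset? λ τ →
  IsFace? C τ ×-dec σ ⊂? τ ×-dec
  allSubset? λ τ′ → IsFace? C τ′ →-dec σ ⊂? τ′ →-dec τ′ ≟ˢ τ

SingleVertex? : (C : Faces n) → Dec (SingleVertex C)
SingleVertex? C = Fin.any? λ v → IsFace? C ⁅ v ⁆ ×-dec
  Fin.all? λ w → IsFace? C ⁅ w ⁆ →-dec w Fin.≟ v

MoreThanOneVertex? : (C : Faces n) → Dec (MoreThanOneVertex C)
MoreThanOneVertex? C = Fin.any? λ v → Fin.any? λ w →
  IsFace? C ⁅ v ⁆ ×-dec IsFace? C ⁅ w ⁆ ×-dec ¬? (v Fin.≟ w)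

DownClosed? : (C : Faces n) → Dec (DownClosed C)
DownClosed? C = allSubset? λ σ → allSubset? λ τ → τ ⊆? σ →-dec IsFace? C σ →-dec IsFace? C τ

data Strategy (n : ℕ) : Set where
  stop  : Strategy n
  query : Fin n → (onLink onDeletion : Strategy n) → Strategy n

nonEvasiveBy : Strategy n → (C : Faces n) → Maybe (NonEvasive C)
nonEvasiveBy stop C with SingleVertex? C
... | yes one = just (single one)
... | no _    = nothing
nonEvasiveBy (query v onLink onDeletion) C =
  dec⇒maybe (MoreThanOneVertex? C)       >>= λ many →
  dec⇒maybe (IsFace? C ⁅ v ⁆)            >>= λ isVertex →
  nonEvasiveBy onLink (link C v)         >>= λ neLink →
  nonEvasiveBy onDeletion (deletion C v) >>= λ neDeletion →
  just (step many v isVertex neLink neDeletion)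

generatedBy : List (Subset n) → Faces n
generatedBy facets σ = any (λ τ → does (σ ⊆? τ)) facets


NonEvasive-resp : C ≗ D → NonEvasive C → NonEvasive D
NonEvasive-resp C≗D (single (v , isV , unique)) =
  single (v , trans (sym (C≗D _)) isV , λ w → unique w ∘ trans (C≗D _))
NonEvasive-resp C≗D (step (u , w , isU , isW , u≢w) v isV neLink neDeletion) =
  step (u , w , trans (sym (C≗D _)) isU , trans (sym (C≗D _)) isW , u≢w) v (trans (sym (C≗D _)) isV)
    (NonEvasive-resp (λ σ → cong (not _ ∧_) (C≗D _)) neLink)
    (NonEvasive-resp (λ σ → cong (not _ ∧_) (C≗D _)) neDeletion)

NonEvasive⇒vertex : NonEvasive C → ∃[ v ] IsVertex C v
NonEvasive⇒vertex (single (v , isV , _)) = v , isV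
NonEvasive⇒vertex (step _ v isV _ _)     = v , isV

complex : (C : Faces n) → DownClosed C → NonEvasive C → SimplicialComplex n
complex C C-closed neC = record
  { face = C ; nonempty = let (v , isV) = NonEvasive⇒vertex neC in ⁅ v ⁆ , isV ; closed = C-closed }

shift : Faces n → Faces (suc n)
shift C (b ∷ σ) = not b ∧ C σ

shift-link : ∀ (C : Faces n) v → shift (link C v) ≗ link (shift C) (suc v)
shift-link C v (outside ∷ σ) = refl
shift-link C v (inside ∷ σ)  = sym (Bool.∧-zeroʳ _)

shift-deletion : ∀ (C : Faces n) v → shift (deletion C v) ≗ deletion (shift C) (suc v)
shift-deletion C v (outside ∷ σ) = refl
shift-deletion C v (inside ∷ σ)  = sym (Bool.∧-zeroʳ _)

shift-nonEvasive : NonEvasive C → NonEvasive (shift C)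
shift-nonEvasive {C = C} (single (v , isV , unique)) = single (suc v , isV , unique′)
  where
  unique′ : ∀ w → IsVertex (shift C) w → w ≡ suc v
  unique′ (suc w) isW = cong suc (unique w isW)
shift-nonEvasive {C = C} (step (u , w , isU , isW , u≢w) v isV neLink neDeletion) =
  step (suc u , suc w , isU , isW , u≢w ∘ Fin.suc-injective) (suc v) isV
    (NonEvasive-resp (shift-link C v) (shift-nonEvasive neLink))
    (NonEvasive-resp (shift-deletion C v) (shift-nonEvasive neDeletion))

-- cone X Y = Y ∪ (zero ∗ X): the faces σ of Y together with the faces
-- zero ∪ σ for σ in X. It is a simplicial complex when X ⊆ Y.
cone : Faces n → Faces n → Faces (suc n)
cone X Y (inside ∷ σ)  = X σ
cone X Y (outside ∷ σ) = Y σ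

link-cone : ∀ (X Y : Faces n) → shift X ≗ link (cone X Y) zero
link-cone X Y (outside ∷ σ) = cong X (sym (∪-identityʳ σ))
link-cone X Y (inside ∷ σ)  = refl

deletion-cone : ∀ (X Y : Faces n) → shift Y ≗ deletion (cone X Y) zero
deletion-cone X Y (outside ∷ σ) = refl
deletion-cone X Y (inside ∷ σ)  = refl

cone-nonEvasive : DownClosed X → NonEvasive X → NonEvasive Y → NonEvasive (cone X Y)
cone-nonEvasive {X = X} {Y} X-closed neX neY
  with NonEvasive⇒vertex neX | NonEvasive⇒vertex neY
... | v , isV | w , isW =
  step (zero , suc w , X∅ , isW , λ ()) zero X∅
    (NonEvasive-resp (link-cone X Y) (shift-nonEvasive neX))
    (NonEvasive-resp (deletion-cone X Y) (shift-nonEvasive neY))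
  where
  X∅ : IsFace X ⊥
  X∅ = X-closed ⁅ v ⁆ ⊥ ⊥⊆ isV


inside⊈outside : ∀ {p q : Subset n} → ¬ inside ∷ p ⊆ outside ∷ q
inside⊈outside p⊆q with p⊆q here
... | ()

cone-free : ∀ σ → IsFree X σ → IsFree (cone X Y) (inside ∷ σ)
cone-free {X = X} {Y} σ (isσ , τ , isτ , σ⊂τ , unique) =
  isσ , inside ∷ τ , isτ , in⊂in σ⊂τ , unique′
  where
  unique′ : ∀ τ′ → IsFace (cone X Y) τ′ → inside ∷ σ ⊂ τ′ → τ′ ≡ inside ∷ τ
  unique′ (inside ∷ τ′) isτ′ σ⊂τ′ = cong (inside ∷_) (unique τ′ isτ′ (drop-∷-⊂ σ⊂τ′))
  unique′ (outside ∷ τ′) _ (σ⊆τ′ , _) = ⊥-elim (inside⊈outside σ⊆τ′)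

cone-free⁻ : ∀ σ → IsFree (cone X Y) (inside ∷ σ) → IsFree X σ
cone-free⁻ σ (_ , outside ∷ τ , _ , (σ⊆τ , _) , _) = ⊥-elim (inside⊈outside σ⊆τ)
cone-free⁻ σ (isσ , inside ∷ τ , isτ , σ⊂τ , unique) =
  isσ , τ , isτ , drop-∷-⊂ σ⊂τ , λ τ′ isτ′ σ⊂τ′ → cong tail (unique (inside ∷ τ′) isτ′ (in⊂in σ⊂τ′))

HasTwoAdjacentFreeFaces : Faces n → Set
HasTwoAdjacentFreeFaces C = ∃[ σ₁ ] ∃[ σ₂ ] (ExactlyTwoFree C σ₁ σ₂ ×
  ∃[ ρ ] (CodimOneFace C ρ σ₁ × CodimOneFace C ρ σ₂))

cone-codimOne : ∀ {ρ σ} → CodimOneFace X ρ σ → CodimOneFace (cone X Y) (inside ∷ ρ) (inside ∷ σ)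
cone-codimOne (isρ , ρ⊆σ , size) = isρ , s⊆s ρ⊆σ , cong suc size

cone-closed : DownClosed X → DownClosed Y → (∀ σ → IsFace X σ → IsFace Y σ) → DownClosed (cone X Y)
cone-closed X-closed Y-closed X⊆Y (inside ∷ σ)  (inside ∷ τ)  τ⊆σ isσ = X-closed σ τ (drop-∷-⊆ τ⊆σ) isσ
cone-closed X-closed Y-closed X⊆Y (inside ∷ σ)  (outside ∷ τ) τ⊆σ isσ = Y-closed σ τ (drop-∷-⊆ τ⊆σ) (X⊆Y σ isσ)
cone-closed X-closed Y-closed X⊆Y (outside ∷ σ) (inside ∷ τ)  τ⊆σ isσ = ⊥-elim (inside⊈outside τ⊆σ)
cone-closed X-closed Y-closed X⊆Y (outside ∷ σ) (outside ∷ τ) τ⊆σ isσ = Y-closed σ τ (drop-∷-⊆ τ⊆σ) isσ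

-- The conditions on X ⊆ Y under which coning X into Y creates no new free faces.
record Thickening (X Y : Faces n) : Set where
  field
    X-closed   : DownClosed X
    Y-closed   : DownClosed Y
    nonMaximal : ∀ σ → IsFace X σ → ∃[ τ ] (IsFace Y τ × σ ⊂ τ)
    free⊆X     : ∀ σ → IsFree Y σ → IsFace X σ

  X⊆Y : ∀ σ → IsFace X σ → IsFace Y σ
  X⊆Y σ isσ = let (τ , isτ , σ⊂τ) = nonMaximal σ isσ in Y-closed τ σ (proj₁ σ⊂τ) isτ

module _ {X Y : Faces n} (T : Thickening X Y) where
  open Thickening T

  cone-base-notFree : ∀ σ → ¬ IsFree (cone X Y) (outside ∷ σ)
  cone-base-notFree σ (isσ , τ , isτ , σ⊂τ , unique) with IsFace? X σ
  ... | yes inX = twoCofaces (nonMaximal σ inX)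
    where
    twoCofaces : ¬ (∃[ τ′ ] (IsFace Y τ′ × σ ⊂ τ′))
    twoCofaces (τ′ , isτ′ , σ⊂τ′)
      with trans (unique (inside ∷ σ) inX (out⊂in ⊆-refl)) (sym (unique (outside ∷ τ′) isτ′ (out⊂ σ⊂τ′)))
    ... | ()
  ... | no notInX = notInX (free⊆X σ (freeInY τ isτ σ⊂τ unique))
    where
    freeInY : ∀ τ → IsFace (cone X Y) τ → outside ∷ σ ⊂ τ →
              (∀ τ′ → IsFace (cone X Y) τ′ → outside ∷ σ ⊂ τ′ → τ′ ≡ τ) → IsFree Y σ
    freeInY (inside ∷ τ) isτ σ⊂τ _ = contradiction (X-closed τ σ (drop-∷-⊆ (proj₁ σ⊂τ)) isτ) notInX
    freeInY (outside ∷ τ) isτ σ⊂τ unique =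
      isσ , τ , isτ , drop-∷-⊂ σ⊂τ , λ τ′ isτ′ σ⊂τ′ → cong tail (unique (outside ∷ τ′) isτ′ (out⊂ σ⊂τ′))

  cone-thickening : Thickening (cone X Y) (cone Y Y)
  cone-thickening = record
    { X-closed   = cone-closed X-closed Y-closed X⊆Y
    ; Y-closed   = cone-closed Y-closed Y-closed (λ _ isσ → isσ)
    ; nonMaximal = nonMaximal′
    ; free⊆X     = free⊆X′
    }
    where
    nonMaximal′ : ∀ σ → IsFace (cone X Y) σ → ∃[ τ ] (IsFace (cone Y Y) τ × σ ⊂ τ)
    nonMaximal′ (inside ∷ σ) isσ = let (τ , isτ , σ⊂τ) = nonMaximal σ isσ in inside ∷ τ , isτ , in⊂in σ⊂τ
    nonMaximal′ (outside ∷ σ) isσ = inside ∷ σ , isσ , out⊂in ⊆-refl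
    free⊆X′ : ∀ σ → IsFree (cone Y Y) σ → IsFace (cone X Y) σ
    free⊆X′ (inside ∷ σ) free = free⊆X σ (cone-free⁻ σ free)
    free⊆X′ (outside ∷ σ) (isσ , _) = isσ

  cone-twoAdjacentFreeFaces : HasTwoAdjacentFreeFaces X → HasTwoAdjacentFreeFaces (cone X Y)
  cone-twoAdjacentFreeFaces (σ₁ , σ₂ , (σ₁≢σ₂ , free₁ , free₂ , onlyFree) , ρ , ρσ₁ , ρσ₂) =
    inside ∷ σ₁ , inside ∷ σ₂ ,
    (σ₁≢σ₂ ∘ cong tail , cone-free σ₁ free₁ , cone-free σ₂ free₂ , onlyFree′) ,
    inside ∷ ρ , cone-codimOne {X = X} {Y} ρσ₁ , cone-codimOne {X = X} {Y} ρσ₂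
    where
    onlyFree′ : ∀ σ → IsFree (cone X Y) σ → σ ≡ inside ∷ σ₁ ⊎ σ ≡ inside ∷ σ₂
    onlyFree′ (outside ∷ σ) free = ⊥-elim (cone-base-notFree σ free)
    onlyFree′ (inside ∷ σ) free =
      Sum.map (cong (inside ∷_)) (cong (inside ∷_)) (onlyFree σ (cone-free⁻ σ free))


DimensionAtMost : Faces n → ℕ → Set
DimensionAtMost C d = ∀ σ → IsFace C σ → ∣ σ ∣ ≤ suc d

cone-dimensionAtMost : ∀ {d} → DimensionAtMost X d → DimensionAtMost Y (suc d) →
                       DimensionAtMost (cone X Y) (suc d)
cone-dimensionAtMost dimX dimY (inside ∷ σ)  isσ = s≤s (dimX σ isσ)
cone-dimensionAtMost dimX dimY (outside ∷ σ) isσ = dimY σ isσ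

cone-dimension : ∀ {d} → HasDimension X d → DimensionAtMost Y (suc d) →
                 HasDimension (cone X Y) (suc d)
cone-dimension ((σ , isσ , size) , dimX) dimY =
  (inside ∷ σ , isσ , cong suc size) , cone-dimensionAtMost dimX dimY


module Tower (X Y : Faces n) where

  outer : ∀ m → Faces (m + n)
  outer zero    = Y
  outer (suc m) = cone (outer m) (outer m)

  inner : ∀ m → Faces (m + n)
  inner zero    = X
  inner (suc m) = cone (inner m) (outer m)

  module _ (T : Thickening X Y) where

    thickening : ∀ m → Thickening (inner m) (outer m)
    thickening zero    = T
    thickening (suc m) = cone-thickening (thickening m)

    outer-nonEvasive : NonEvasive Y → ∀ m → NonEvasive (outer m)
    outer-nonEvasive neY zero    = neY
    outer-nonEvasive neY (suc m) =
      cone-nonEvasive (Thickening.Y-closed (thickening m)) (outer-nonEvasive neY m) (outer-nonEvasive neY m)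

    inner-nonEvasive : NonEvasive X → NonEvasive Y → ∀ m → NonEvasive (inner m)
    inner-nonEvasive neX neY zero    = neX
    inner-nonEvasive neX neY (suc m) =
      cone-nonEvasive (Thickening.X-closed (thickening m)) (inner-nonEvasive neX neY m) (outer-nonEvasive neY m)

    inner-twoAdjacentFreeFaces : HasTwoAdjacentFreeFaces X → ∀ m → HasTwoAdjacentFreeFaces (inner m)
    inner-twoAdjacentFreeFaces twoX zero    = twoX
    inner-twoAdjacentFreeFaces twoX (suc m) = cone-twoAdjacentFreeFaces (thickening m) (inner-twoAdjacentFreeFaces twoX m)

  module _ {d} (dimY : DimensionAtMost Y (suc d)) where

    outer-dimensionAtMost : ∀ m → DimensionAtMost (outer m) (suc (m + d))
    outer-dimensionAtMost zero    = dimY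
    outer-dimensionAtMost (suc m) = cone-dimensionAtMost bound (λ σ → m≤n⇒m≤1+n ∘ bound σ)
      where bound = outer-dimensionAtMost m

    inner-dimension : HasDimension X d → ∀ m → HasDimension (inner m) (m + d)
    inner-dimension dimX zero    = dimX
    inner-dimension dimX (suc m) = cone-dimension (inner-dimension dimX m) (outer-dimensionAtMost m)


pattern I = inside
pattern O = outside

-- B has triangles 013, 023, 024, 034, 124, 134.
A B : Faces 5
A = generatedBy ((I ∷ I ∷ O ∷ O ∷ O ∷ []) ∷ (O ∷ I ∷ I ∷ O ∷ O ∷ []) ∷ (O ∷ O ∷ I ∷ I ∷ O ∷ []) ∷ [])
B = generatedBy ((I ∷ I ∷ O ∷ I ∷ O ∷ []) ∷ (I ∷ O ∷ I ∷ I ∷ O ∷ []) ∷ (I ∷ O ∷ I ∷ O ∷ I ∷ []) ∷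
                 (I ∷ O ∷ O ∷ I ∷ I ∷ []) ∷ (O ∷ I ∷ I ∷ O ∷ I ∷ []) ∷ (O ∷ I ∷ O ∷ I ∷ I ∷ []) ∷ [])

A-nonEvasive : NonEvasive A
A-nonEvasive = from-just (nonEvasiveBy (query (# 0) stop (query (# 1) stop (query (# 2) stop stop))) A)

B-nonEvasive : NonEvasive B
B-nonEvasive = from-just (nonEvasiveBy
  (query (# 1) (query (# 0) stop (query (# 2) stop (query (# 3) stop stop)))
               (query (# 2) (query (# 3) stop (query (# 0) stop stop))
                            (query (# 0) (query (# 3) stop stop) (query (# 3) stop stop)))) B)

A-B-thickening : Thickening A B
A-B-thickening = record
  { X-closed   = from-yes (DownClosed? A)
  ; Y-closed   = from-yes (DownClosed? B)
  ; nonMaximal = from-yes (allSubset? λ σ → IsFace? A σ →-dec anySubset? λ τ → IsFace? B τ ×-dec σ ⊂? τ)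
  ; free⊆X     = from-yes (allSubset? λ σ → IsFree? B σ →-dec IsFace? A σ)
  }

A-twoAdjacentFreeFaces : HasTwoAdjacentFreeFaces A
A-twoAdjacentFreeFaces =
  v₀ , v₃ , from-yes (¬? (v₀ ≟ˢ v₃) ×-dec IsFree? A v₀ ×-dec IsFree? A v₃ ×-dec
                      allSubset? λ σ → IsFree? A σ →-dec (σ ≟ˢ v₀ ⊎-dec σ ≟ˢ v₃)) ,
  ⊥ , (refl , ⊥⊆ , refl) , (refl , ⊥⊆ , refl)
  where
  v₀ v₃ : Subset 5
  v₀ = I ∷ O ∷ O ∷ O ∷ O ∷ []
  v₃ = O ∷ O ∷ O ∷ I ∷ O ∷ []

A-dimension : HasDimension A 1
A-dimension = (I ∷ I ∷ O ∷ O ∷ O ∷ [] , refl , refl) , from-yes (allSubset? λ σ → IsFace? A σ →-dec ∣ σ ∣ ≤? 2)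

B-dimensionAtMost : DimensionAtMost B 2
B-dimensionAtMost = from-yes (allSubset? λ σ → IsFace? B σ →-dec ∣ σ ∣ ≤? 3)

theorem2p5 : (d : ℕ) → d ≥ 1 →
    ∃[ n ] ∃[ E ] (HasDimension (face {n} E) d × NonEvasive (face E) ×
      ∃[ σ₁ ] ∃[ σ₂ ] (ExactlyTwoFree (face E) σ₁ σ₂ ×
        ∃[ ρ ] (CodimOneFace (face E) ρ σ₁ × CodimOneFace (face E) ρ σ₂)))
theorem2p5 (suc k) _ =
  k + 5 , complex (inner k) (Thickening.X-closed (thickening A-B-thickening k)) Eₖ-nonEvasive ,
  subst (HasDimension (inner k)) (+-comm k 1) (inner-dimension B-dimensionAtMost A-dimension k) ,
  Eₖ-nonEvasive ,
  inner-twoAdjacentFreeFaces A-B-thickening A-twoAdjacentFreeFaces k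
  where
  open Tower A B
  Eₖ-nonEvasive : NonEvasive (inner k)
  Eₖ-nonEvasive = inner-nonEvasive A-B-thickening A-nonEvasive B-nonEvasive k
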